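{- For any graph $G$ and integer $k\geq\max\{\mathrm{tw}(G),1\}$, there is a tree-decomposition of $G$ with width at most $3k-1$ and order at most $\max\{\frac{|V(G)|}{k}-1,1\}$.
   Context: Graphs are simple, undirected and finite. For a non-empty tree $T$, a $T$-decomposition of a graph $G$ is a collection $(B_x:x\in V(T))$ of subsets $B_x\subseteq V(G)$ (bags) such that for each edge $vw\in E(G)$ some bag contains both $v$ and $w$, and for each $v\in V(G)$ the set $\{x\in V(T):v\in B_x\}$ induces a non-empty connected subtree of $T$. A tree-decomposition is a $T$-decomposition for some tree $T$. Its width is $\max_x|B_x|-1$, and its order is $|V(T)|$. $\mathrm{tw}(G)$ denotes the treewidth of $G$, the minimum width of a tree-decomposition of $G$. -}

module Defs where

open import Data.Nat using (ℕ; zero; suc; _+_; _*_; _≤_; _<_)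
open import Data.Fin using (Fin; toℕ)
open import Data.Fin.Subset using (Subset; _∈_; ∣_∣)
open import Data.Product using (Σ; _×_; _,_; ∃)
open import Data.Sum using (_⊎_)
open import Relation.Nullary using (¬_)
open import Relation.Binary.PropositionalEquality using (_≡_)

record Graph (n : ℕ) : Set₁ where
  field
    Adj    : Fin n → Fin n → Set
    sym    : ∀ {u v} → Adj u v → Adj v u
    irrefl : ∀ {v} → ¬ Adj v v

-- A (non-empty) tree on node set Fin (suc m), given as a rooted labelled tree:
-- node 0 is the root and every other node i has a parent p i with p i < i.
-- The tree edges are exactly {i , parent i} for i ≠ 0.  Every finite
-- non-empty tree is isomorphic to one of this form (built by adding leaves).
record Tree (m : ℕ) : Set where
  field
    parent    : Fin (suc m) → Fin (suc m)
    parent-lt : ∀ i → ¬ (toℕ i ≡ 0) → toℕ (parent i) < toℕ i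

TreeEdge : ∀ {m} → Tree m → Fin (suc m) → Fin (suc m) → Set
TreeEdge T x y =
  (¬ (toℕ x ≡ 0) × Tree.parent T x ≡ y) ⊎ (¬ (toℕ y ≡ 0) × Tree.parent T y ≡ x)

data Reach {m} (T : Tree m) (S : Fin (suc m) → Set) :
           Fin (suc m) → Fin (suc m) → Set where
  here : ∀ {x} → S x → Reach T S x x
  step : ∀ {x y z} → S x → TreeEdge T x y → Reach T S y z → Reach T S x z

ConnectedSubtree : ∀ {m} → Tree m → (Fin (suc m) → Set) → Set
ConnectedSubtree T S = (∃ λ x → S x) × (∀ x y → S x → S y → Reach T S x y)

record IsTDecomposition {n m} (G : Graph n) (T : Tree m)
                        (B : Fin (suc m) → Subset n) : Set where
  field
    edges    : ∀ v w → Graph.Adj G v w → ∃ λ x → (v ∈ B x) × (w ∈ B x)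
    subtrees : ∀ v → ConnectedSubtree T (λ x → v ∈ B x)

-- A tree-decomposition of G of order (suc m)
record TreeDecomposition {n} (G : Graph n) (m : ℕ) : Set where
  field
    tree  : Tree m
    bags  : Fin (suc m) → Subset n
    isDec : IsTDecomposition G tree bags

WidthAtMost : ∀ {n m} {G : Graph n} → TreeDecomposition G m → ℕ → Set
WidthAtMost D w = ∀ x → ∣ TreeDecomposition.bags D x ∣ ≤ suc w

TwAtMost : ∀ {n} → Graph n → ℕ → Set
TwAtMost G k = Σ ℕ λ m → Σ (TreeDecomposition G m) λ D → WidthAtMost D k

module Submission where

-- Work inside a set A of vertices, starting from A = V(G), and build a
-- tree-decomposition of G[A] with bags of size at most 3k such that every bag
-- B x ∩ A of the given width-k decomposition lies inside one of its bags.  If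
-- |A| ≤ 3k a single bag does it.  Otherwise take a deepest node y whose subtree
-- holds at least k vertices of A outside B y; every child subtree of y then holds
-- at most 2k vertices of A.  Add child subtrees of y one at a time until they hold
-- at least k vertices of A outside B y, and let L be the vertices of A in them;
-- if the last subtree alone already holds k such vertices, keep only it.  Either
-- way |L| ≤ 3k, at worst (k - 1) + (k - 1) + (k + 1).  Since y separates these
-- subtrees from the rest of the tree, the set P = L - B y meets no other bag.
-- So decompose A - P recursively and attach a leaf with bag L at the bag
-- containing B y ∩ A.  Each leaf removes at least k vertices of A, which bounds
-- the order.

open import Defs
open import Data.Nat using (ℕ; suc; _+_; _*_; _∸_; _≤_)
open import Data.Product using (Σ; _×_)
open import Data.Sum using (_⊎_)

open import Level using (0ℓ)
open import Data.Bool using (true; false)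
open import Data.Empty using (⊥-elim)
open import Data.Fin as F using (Fin; zero; suc; toℕ; inject₁; fromℕ; fromℕ<)
open import Data.Fin.Induction using () renaming (<-wellFounded to <-wellFounded-Fin)
open import Data.Fin.Properties using (any?; toℕ-injective; toℕ<n; toℕ-inject₁; toℕ-fromℕ; toℕ-fromℕ<)
open import Data.Fin.Subset using (Subset; _∈_; _∉_; _⊆_; ∣_∣; _∪_; _∩_; _─_; Empty; ⊤)
open import Data.Fin.Subset.Properties
open import Data.Nat as ℕ using (zero; _<_; z≤n; s≤s; s≤s⁻¹; _≤?_)
open import Data.Nat.Induction using (<-wellFounded)
open import Data.Nat.Properties
open import Data.Product using (∃; _,_; proj₁; proj₂)
open import Data.Sum using (inj₁; inj₂; [_,_]′; map; map₂)
open import Data.Vec using ([]; _∷_; tabulate; there)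
open import Data.Vec.Properties using ([]=⇒lookup; lookup⇒[]=; lookup∘tabulate)
open import Function using (_∘_; _on_; id)
open import Induction.WellFounded using (Acc; acc)
open import Relation.Binary.PropositionalEquality
import Relation.Binary.Construct.On as On
open import Relation.Nullary using (¬_; ¬?; Dec; yes; no; does)
open import Relation.Nullary.Decidable using (_×-dec_; dec-true; decidable-stable)
open import Relation.Unary using (Pred; Decidable)

∣p∪q∣≤∣p∣+∣q∣ : ∀ {n} (p q : Subset n) → ∣ p ∪ q ∣ ≤ ∣ p ∣ + ∣ q ∣
∣p∪q∣≤∣p∣+∣q∣ []          []          = z≤n
∣p∪q∣≤∣p∣+∣q∣ (true ∷ p)  (true  ∷ q) =
  s≤s (≤-trans (∣p∪q∣≤∣p∣+∣q∣ p q) (+-monoʳ-≤ ∣ p ∣ (n≤1+n ∣ q ∣)))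
∣p∪q∣≤∣p∣+∣q∣ (true ∷ p)  (false ∷ q) = s≤s (∣p∪q∣≤∣p∣+∣q∣ p q)
∣p∪q∣≤∣p∣+∣q∣ (false ∷ p) (true  ∷ q) =
  subst (suc ∣ p ∪ q ∣ ≤_) (sym (+-suc ∣ p ∣ ∣ q ∣)) (s≤s (∣p∪q∣≤∣p∣+∣q∣ p q))
∣p∪q∣≤∣p∣+∣q∣ (false ∷ p) (false ∷ q) = ∣p∪q∣≤∣p∣+∣q∣ p q

∣p∣≡∣p∩q∣+∣p─q∣ : ∀ {n} (p q : Subset n) → ∣ p ∣ ≡ ∣ p ∩ q ∣ + ∣ p ─ q ∣
∣p∣≡∣p∩q∣+∣p─q∣ []          []          = refl
∣p∣≡∣p∩q∣+∣p─q∣ (true ∷ p)  (true  ∷ q) = cong suc (∣p∣≡∣p∩q∣+∣p─q∣ p q)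
∣p∣≡∣p∩q∣+∣p─q∣ (true ∷ p)  (false ∷ q) =
  trans (cong suc (∣p∣≡∣p∩q∣+∣p─q∣ p q)) (sym (+-suc ∣ p ∩ q ∣ ∣ p ─ q ∣))
∣p∣≡∣p∩q∣+∣p─q∣ (false ∷ p) (true  ∷ q) = ∣p∣≡∣p∩q∣+∣p─q∣ p q
∣p∣≡∣p∩q∣+∣p─q∣ (false ∷ p) (false ∷ q) = ∣p∣≡∣p∩q∣+∣p─q∣ p q

∣p∣≤∣q∣+∣p─q∣ : ∀ {n} (p q : Subset n) → ∣ p ∣ ≤ ∣ q ∣ + ∣ p ─ q ∣
∣p∣≤∣q∣+∣p─q∣ p q = begin
  ∣ p ∣                  ≡⟨ ∣p∣≡∣p∩q∣+∣p─q∣ p q ⟩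
  ∣ p ∩ q ∣ + ∣ p ─ q ∣  ≤⟨ +-monoˡ-≤ ∣ p ─ q ∣ (∣p∩q∣≤∣q∣ p q) ⟩
  ∣ q ∣ + ∣ p ─ q ∣      ∎
  where open ≤-Reasoning

x∈p─q⇒x∉q : ∀ {n} (p q : Subset n) {x} → x ∈ p ─ q → x ∉ q
x∈p─q⇒x∉q (_ ∷ _) (true  ∷ _) {zero}  ()
x∈p─q⇒x∉q (_ ∷ _) (false ∷ _) {zero}  _           ()
x∈p─q⇒x∉q (_ ∷ p) (_     ∷ q) {suc x} (there x∈) (there x∈q) = x∈p─q⇒x∉q p q x∈ x∈q

x∈p∧x∉p─q⇒x∈q : ∀ {n} {p q : Subset n} {x} → x ∈ p → x ∉ p ─ q → x ∈ q
x∈p∧x∉p─q⇒x∈q {q = q} {x} x∈p x∉p─q with x ∈? q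
... | yes x∈q = x∈q
... | no  x∉q = ⊥-elim (x∉p─q (x∈p∧x∉q⇒x∈p─q x∈p x∉q))

opaque
  ⋃[_]_ : ∀ {m n} {R : Pred (Fin m) 0ℓ} → Decidable R → (Fin m → Subset n) → Subset n
  ⋃[ R? ] C = tabulate (λ v → does (any? (λ x → R? x ×-dec v ∈? C x)))

  ∈-⋃⁺ : ∀ {m n} {R : Pred (Fin m) 0ℓ} (R? : Decidable R) {C : Fin m → Subset n} {x v} →
         R x → v ∈ C x → v ∈ ⋃[ R? ] C
  ∈-⋃⁺ R? {C} {x} {v} rx v∈ =
    lookup⇒[]= v _ (trans (lookup∘tabulate _ v) (dec-true (any? (λ x → R? x ×-dec v ∈? C x)) (x , rx , v∈)))

  ∈-⋃⁻ : ∀ {m n} {R : Pred (Fin m) 0ℓ} (R? : Decidable R) {C : Fin m → Subset n} {v} →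
         v ∈ ⋃[ R? ] C → ∃ λ x → R x × v ∈ C x
  ∈-⋃⁻ R? {C} {v} v∈ with any? (λ x → R? x ×-dec v ∈? C x) | trans (sym (lookup∘tabulate _ v)) ([]=⇒lookup v∈)
  ... | yes found | _ = found

largest : ∀ {n} {P : Pred (Fin n) 0ℓ} → Decidable P → ∀ {i} → P i →
          ∃ λ j → P j × (∀ {z} → j F.< z → ¬ P z)
largest {suc n} P? {i} pi with any? (P? ∘ suc) | i
... | yes (i′ , pi′) | _ with largest (P? ∘ suc) pi′
...   | j , pj , above = suc j , pj , λ { {suc z} (s≤s j<z) → above j<z }
largest {suc n} P? {i} pi | no none | zero  = zero , pi , λ { {suc z} _ pz → none (z , pz) }
largest {suc n} P? {i} pi | no none | suc i′ = ⊥-elim (none (i′ , pi))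

crossing : ∀ (f : ℕ → ℕ) {k} N → f 0 < k → k ≤ f N →
           ∃ λ t → t < N × f t < k × k ≤ f (suc t)
crossing f zero    f0<k k≤f0 = ⊥-elim (<-irrefl refl (<-≤-trans f0<k k≤f0))
crossing f {k} (suc N) f0<k k≤fN with k ≤? f N
... | yes k≤f = let t , t<N , below , above = crossing f N f0<k k≤f in t , m≤n⇒m≤1+n t<N , below , above
... | no  k≰f = N , ≤-refl , ≰⇒> k≰f , k≤fN

IsRoot : ∀ {m} → Fin m → Set
IsRoot x = toℕ x ≡ 0

module _ {m} (T : Tree m) where
  open Tree T

  data Descendant : Fin (suc m) → Fin (suc m) → Set where
    self : ∀ {x} → Descendant x x
    up   : ∀ {x y} → ¬ IsRoot x → Descendant (parent x) y → Descendant x y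

  descendant? : ∀ x y → Dec (Descendant x y)
  descendant? x y = go x (<-wellFounded-Fin x)
    where
    go : ∀ x → Acc F._<_ x → Dec (Descendant x y)
    go x (acc rec) with x F.≟ y | toℕ x ℕ.≟ 0
    ... | yes refl | _ = yes self
    ... | no x≢y | yes root = no λ { self → x≢y refl ; (up nonroot _) → nonroot root }
    ... | no x≢y | no nonroot with go (parent x) (rec (parent-lt x nonroot))
    ...   | yes d = yes (up nonroot d)
    ...   | no ¬d = no λ { self → x≢y refl ; (up _ d) → ¬d d }

  descendant-root : ∀ x → Descendant x zero
  descendant-root x = go x (<-wellFounded-Fin x)
    where
    go : ∀ x → Acc F._<_ x → Descendant x zero
    go x (acc rec) with toℕ x ℕ.≟ 0
    ... | yes root = subst (Descendant x) (toℕ-injective root) self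
    ... | no nonroot = up nonroot (go (parent x) (rec (parent-lt x nonroot)))

  IsChild : Fin (suc m) → Fin (suc m) → Set
  IsChild y d = ¬ IsRoot d × parent d ≡ y

  child? : ∀ y d → Dec (IsChild y d)
  child? y d = ¬? (toℕ d ℕ.≟ 0) ×-dec (parent d F.≟ y)

  parent<child : ∀ {y d} → IsChild y d → y F.< d
  parent<child {d = d} (nonroot , refl) = parent-lt d nonroot

  child-of-descendant : ∀ {x y} → Descendant x y → x ≢ y → ∃ λ d → IsChild y d × Descendant x d
  child-of-descendant self x≢y = ⊥-elim (x≢y refl)
  child-of-descendant {x} {y} (up nonroot d) x≢y with parent x F.≟ y
  ... | yes refl = x , (nonroot , refl) , self
  ... | no p≢y = let c , c-child , dc = child-of-descendant d p≢y in c , c-child , up nonroot dc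

  edge-sym : ∀ {x y} → TreeEdge T x y → TreeEdge T y x
  edge-sym (inj₁ e) = inj₂ e
  edge-sym (inj₂ e) = inj₁ e

  reach-head : ∀ {S a b} → Reach T S a b → S a
  reach-head (here s)     = s
  reach-head (step s _ _) = s

  reach-trans : ∀ {S a b c} → Reach T S a b → Reach T S b c → Reach T S a c
  reach-trans (here _)     r′ = r′
  reach-trans (step s e r) r′ = step s e (reach-trans r r′)

  Branches : Pred (Fin (suc m)) 0ℓ → Pred (Fin (suc m)) 0ℓ
  Branches D x = ∃ λ d → D d × Descendant x d

  branches? : ∀ {D} → Decidable D → Decidable (Branches D)
  branches? D? x = any? (λ d → D? d ×-dec descendant? x d)

  module _ {y} {D : Pred (Fin (suc m)) 0ℓ} (D? : Decidable D) (children : ∀ {d} → D d → IsChild y d) where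

    branches-closed : ∀ {x} → ¬ IsRoot x → Branches D (parent x) → Branches D x
    branches-closed nonroot (d , dd , desc) = d , dd , up nonroot desc

    branches-exit : ∀ {x} → Branches D x → ¬ Branches D (parent x) → parent x ≡ y
    branches-exit (d , dd , self) _ = proj₂ (children dd)
    branches-exit (d , dd , up _ desc) outside = ⊥-elim (outside (d , dd , desc))

    branches-separate : ∀ {S a b} → Reach T S a b → Branches D a → ¬ Branches D b → S y
    branches-separate (here _) inside outside = ⊥-elim (outside inside)
    branches-separate (step {_} {x′} _ e r) inside outside with branches? D? x′
    ... | yes inside′ = branches-separate r inside′ outside
    ... | no outside′ with e
    ...   | inj₂ (nonroot , refl) = ⊥-elim (outside′ (branches-closed nonroot inside))
    ...   | inj₁ (_ , refl) = subst _ (branches-exit inside outside′) (reach-head r)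

data InjectView : ∀ {n} → Fin (suc n) → Set where
  old : ∀ {n} (j : Fin n) → InjectView (inject₁ j)
  new : ∀ {n} → InjectView (fromℕ n)

injectView : ∀ {n} (i : Fin (suc n)) → InjectView i
injectView {zero}  zero    = new
injectView {suc n} zero    = old zero
injectView {suc n} (suc i) = shift (injectView i)
  where
  shift : ∀ {i : Fin (suc n)} → InjectView i → InjectView (suc i)
  shift (old j) = old (suc j)
  shift new     = new

injectView-inject₁ : ∀ {n} (j : Fin n) → injectView (inject₁ j) ≡ old j
injectView-inject₁ zero    = refl
injectView-inject₁ (suc j) rewrite injectView-inject₁ j = refl

injectView-fromℕ : ∀ n → injectView (fromℕ n) ≡ new
injectView-fromℕ zero    = refl
injectView-fromℕ (suc n) rewrite injectView-fromℕ n = refl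

_▷_ : ∀ {n} {X : Set} → (Fin n → X) → X → Fin (suc n) → X
(f ▷ x) i with injectView i
... | old j = f j
... | new   = x

▷-inject₁ : ∀ {n} {X : Set} (f : Fin n → X) x j → (f ▷ x) (inject₁ j) ≡ f j
▷-inject₁ f x j rewrite injectView-inject₁ j = refl

▷-fromℕ : ∀ {n} {X : Set} (f : Fin n → X) x → (f ▷ x) (fromℕ n) ≡ x
▷-fromℕ {n} f x rewrite injectView-fromℕ n = refl

▷-all : ∀ {n} {X : Set} {f : Fin n → X} {x} (Q : X → Set) → (∀ j → Q (f j)) → Q x → ∀ i → Q ((f ▷ x) i)
▷-all {f = f} {x} Q qf qx i = go (injectView i)
  where
  go : ∀ {i} → InjectView i → Q ((f ▷ x) i)
  go (old j) = subst Q (sym (▷-inject₁ f x j)) (qf j)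
  go new     = subst Q (sym (▷-fromℕ f x)) qx

module _ {m n} (B : Fin m → Subset n) (L : Subset n) {v : Fin n} where

  ∈-▷-inject₁ : ∀ {j} → v ∈ B j → v ∈ (B ▷ L) (inject₁ j)
  ∈-▷-inject₁ {j} = subst (v ∈_) (sym (▷-inject₁ B L j))

  ∈-▷-inject₁⁻ : ∀ {j} → v ∈ (B ▷ L) (inject₁ j) → v ∈ B j
  ∈-▷-inject₁⁻ {j} = subst (v ∈_) (▷-inject₁ B L j)

  ∈-▷-fromℕ : v ∈ L → v ∈ (B ▷ L) (fromℕ m)
  ∈-▷-fromℕ = subst (v ∈_) (sym (▷-fromℕ B L))

  ∈-▷-fromℕ⁻ : v ∈ (B ▷ L) (fromℕ m) → v ∈ L
  ∈-▷-fromℕ⁻ = subst (v ∈_) (▷-fromℕ B L)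

module _ {m} (T : Tree m) (a : Fin (suc m)) where
  open Tree T

  addLeaf : Tree (suc m)
  addLeaf = record { parent = (inject₁ ∘ parent) ▷ inject₁ a ; parent-lt = below }
    where
    below : ∀ i → ¬ IsRoot i → toℕ (((inject₁ ∘ parent) ▷ inject₁ a) i) < toℕ i
    below i nonroot with injectView i
    ... | old j rewrite toℕ-inject₁ (parent j) | toℕ-inject₁ j = parent-lt j nonroot
    ... | new   rewrite toℕ-inject₁ a | toℕ-fromℕ (suc m) = toℕ<n a

  leaf : Fin (suc (suc m))
  leaf = fromℕ (suc m)

  leaf-edge : TreeEdge addLeaf (inject₁ a) leaf
  leaf-edge = inj₂ (nonroot , ▷-fromℕ (inject₁ ∘ parent) (inject₁ a))
    where
    nonroot : ¬ IsRoot leaf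
    nonroot root with () ← trans (sym (toℕ-fromℕ (suc m))) root

  nonroot-inject₁ : ∀ {x : Fin (suc m)} → ¬ IsRoot x → ¬ IsRoot (inject₁ x)
  nonroot-inject₁ {x} nonroot root = nonroot (trans (sym (toℕ-inject₁ x)) root)

  edge-inject₁ : ∀ {x y} → TreeEdge T x y → TreeEdge addLeaf (inject₁ x) (inject₁ y)
  edge-inject₁ (inj₁ (nonroot , refl)) = inj₁ (nonroot-inject₁ nonroot , ▷-inject₁ (inject₁ ∘ parent) (inject₁ a) _)
  edge-inject₁ (inj₂ (nonroot , refl)) = inj₂ (nonroot-inject₁ nonroot , ▷-inject₁ (inject₁ ∘ parent) (inject₁ a) _)

  reach-inject₁ : ∀ {S : Fin (suc m) → Set} {S′ : Fin (suc (suc m)) → Set} →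
                  (∀ {z} → S z → S′ (inject₁ z)) →
                  ∀ {x y} → Reach T S x y → Reach addLeaf S′ (inject₁ x) (inject₁ y)
  reach-inject₁ f (here s)     = here (f s)
  reach-inject₁ f (step s e r) = step (f s) (edge-inject₁ e) (reach-inject₁ f r)

  module _ {n} (B : Fin (suc m) → Subset n) (L : Subset n) (v : Fin n) where

    addLeaf-connected : ConnectedSubtree T (λ z → v ∈ B z) → (v ∈ L → v ∈ B a) →
                  ConnectedSubtree addLeaf (λ z → v ∈ (B ▷ L) z)
    addLeaf-connected ((z , v∈z) , connected) attached =
      (inject₁ z , ∈-▷-inject₁ B L v∈z) , λ i i′ → joined (injectView i) (injectView i′)
      where
      lift = reach-inject₁ (∈-▷-inject₁ B L)
      joined : ∀ {i i′} → InjectView i → InjectView i′ →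
               v ∈ (B ▷ L) i → v ∈ (B ▷ L) i′ → Reach addLeaf (λ z → v ∈ (B ▷ L) z) i i′
      joined (old j) (old j′) v∈i v∈i′ = lift (connected j j′ (∈-▷-inject₁⁻ B L v∈i) (∈-▷-inject₁⁻ B L v∈i′))
      joined (old j) new v∈i v∈leaf =
        reach-trans addLeaf (lift (connected j a (∈-▷-inject₁⁻ B L v∈i) v∈a)) (step (∈-▷-inject₁ B L v∈a) leaf-edge (here v∈leaf))
        where v∈a = attached (∈-▷-fromℕ⁻ B L v∈leaf)
      joined new (old j′) v∈leaf v∈i′ =
        step v∈leaf (edge-sym addLeaf leaf-edge) (lift (connected a j′ v∈a (∈-▷-inject₁⁻ B L v∈i′)))
        where v∈a = attached (∈-▷-fromℕ⁻ B L v∈leaf)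
      joined new new v∈leaf _ = here v∈leaf

    addLeaf-isolated : (∀ z → v ∉ B z) → v ∈ L → ConnectedSubtree addLeaf (λ z → v ∈ (B ▷ L) z)
    addLeaf-isolated absent v∈L = (leaf , ∈-▷-fromℕ B L v∈L) , λ i i′ → joined (injectView i) (injectView i′)
      where
      joined : ∀ {i i′} → InjectView i → InjectView i′ →
               v ∈ (B ▷ L) i → v ∈ (B ▷ L) i′ → Reach addLeaf (λ z → v ∈ (B ▷ L) z) i i′
      joined (old j) _       v∈i _   = ⊥-elim (absent j (∈-▷-inject₁⁻ B L v∈i))
      joined new     (old j) _   v∈i = ⊥-elim (absent j (∈-▷-inject₁⁻ B L v∈i))
      joined new     new     v∈i _   = here v∈i

singleton : Tree 0
singleton = record { parent = λ i → i ; parent-lt = λ { zero nonroot → ⊥-elim (nonroot refl) } }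

3k<a≤1+k+x⇒k≤x : ∀ {k a x} → 3 * k < a → a ≤ suc k + x → k ≤ x
3k<a≤1+k+x⇒k≤x {k} 3k<a a≤ = ≤-trans (m≤m+n k (k + 0)) (+-cancelˡ-≤ k _ _ (s≤s⁻¹ (<-≤-trans 3k<a a≤)))

a<k∧b<k⇒1+k+[a+b]≤3k : ∀ {k a b} → a < k → b < k → suc k + (a + b) ≤ 3 * k
a<k∧b<k⇒1+k+[a+b]≤3k {k} {a} {b} a<k b<k = begin
  suc k + (a + b)    ≡⟨ sym (+-suc k (a + b)) ⟩
  k + (suc a + b)    ≤⟨ +-monoʳ-≤ k (+-mono-≤ a<k (<⇒≤ b<k)) ⟩
  k + (k + k)        ≡⟨ cong (λ c → k + (k + c)) (sym (+-identityʳ k)) ⟩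
  3 * k              ∎
  where open ≤-Reasoning

module Coarsen {n k m} (k≥1 : 1 ≤ k) (T : Tree m) (B : Fin (suc m) → Subset n)
               (narrow : ∀ x → ∣ B x ∣ ≤ suc k)
               (subtrees : ∀ v → ConnectedSubtree T (λ x → v ∈ B x)) where
  open Tree T

  record Coarsening (A : Subset n) : Set where
    field
      {m′}      : ℕ
      tree      : Tree m′
      bags      : Fin (suc m′) → Subset n
      bags⊆A    : ∀ z → bags z ⊆ A
      bag-size  : ∀ z → ∣ bags z ∣ ≤ 3 * k
      connected : ∀ {v} → v ∈ A → ConnectedSubtree tree (λ z → v ∈ bags z)
      image     : Fin (suc m) → Fin (suc m′)
      covers    : ∀ x → B x ∩ A ⊆ bags (image x)
      few-nodes : suc m′ * k + k ≤ ∣ A ∣ ⊎ m′ ≡ 0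

  single-bag : ∀ A → ∣ A ∣ ≤ 3 * k → Coarsening A
  single-bag A small = record
    { tree = singleton ; bags = λ _ → A ; bags⊆A = λ _ v∈A → v∈A ; bag-size = λ _ → small
    ; connected = λ v∈A → (zero , v∈A) , λ { zero zero _ _ → here v∈A }
    ; image = λ _ → zero ; covers = λ x → p∩q⊆q (B x) A ; few-nodes = inj₂ refl }

  module _ (A : Subset n) where

    Bᴬ : Fin (suc m) → Subset n
    Bᴬ x = B x ∩ A

    ∣Bᴬ∣≤1+k : ∀ x → ∣ Bᴬ x ∣ ≤ suc k
    ∣Bᴬ∣≤1+k x = ≤-trans (∣p∩q∣≤∣p∣ (B x) A) (narrow x)

    record Cut : Set₁ where
      field
        centre    : Fin (suc m)
        Branch    : Pred (Fin (suc m)) 0ℓ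
        branch?   : Decidable Branch
        separates : ∀ {v a b} → Branch a → ¬ Branch b → v ∈ B a → v ∈ B b → v ∈ B centre
        large     : k ≤ ∣ ⋃[ branch? ] Bᴬ ─ Bᴬ centre ∣
        small     : ∣ ⋃[ branch? ] Bᴬ ∣ ≤ 3 * k

    branches-separate-bags : ∀ {y} {D : Pred (Fin (suc m)) 0ℓ} (D? : Decidable D) →
                             (∀ {d} → D d → IsChild T y d) →
                             ∀ {v a b} → Branches T D a → ¬ Branches T D b → v ∈ B a → v ∈ B b → v ∈ B y
    branches-separate-bags D? children {v} {a} {b} inside outside v∈a v∈b =
      branches-separate T D? children (proj₂ (subtrees v) a b v∈a v∈b) inside outside

    subtree? : ∀ z → Decidable (Branches T (_≡ z))
    subtree? z = branches? T (F._≟ z)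

    below : Fin (suc m) → Subset n
    below z = ⋃[ subtree? z ] Bᴬ

    Heavy : Pred (Fin (suc m)) 0ℓ
    Heavy z = k ≤ ∣ below z ─ Bᴬ z ∣

    ∣below∣≤1+k+∣below─Bᴬ∣ : ∀ z → ∣ below z ∣ ≤ suc k + ∣ below z ─ Bᴬ z ∣
    ∣below∣≤1+k+∣below─Bᴬ∣ z = ≤-trans (∣p∣≤∣q∣+∣p─q∣ (below z) (Bᴬ z)) (+-monoˡ-≤ _ (∣Bᴬ∣≤1+k z))

    light⇒∣below∣≤k+k : ∀ {z} → ¬ Heavy z → ∣ below z ∣ ≤ k + k
    light⇒∣below∣≤k+k {z} light = begin
      ∣ below z ∣                   ≤⟨ ∣below∣≤1+k+∣below─Bᴬ∣ z ⟩
      suc k + ∣ below z ─ Bᴬ z ∣    ≡⟨ sym (+-suc k _) ⟩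
      k + suc ∣ below z ─ Bᴬ z ∣    ≤⟨ +-monoʳ-≤ k (≰⇒> light) ⟩
      k + k                         ∎
      where open ≤-Reasoning

    module _ (big : 3 * k < ∣ A ∣) where

      root-heavy : Heavy zero
      root-heavy = 3k<a≤1+k+x⇒k≤x big (≤-trans (p⊆q⇒∣p∣≤∣q∣ A⊆below) (∣below∣≤1+k+∣below─Bᴬ∣ zero))
        where
        A⊆below : A ⊆ below zero
        A⊆below {v} v∈A = let x , v∈x = proj₁ (subtrees v) in
          ∈-⋃⁺ (subtree? zero) (zero , refl , descendant-root T x) (x∈p∩q⁺ (v∈x , v∈A))

      -- Parents have smaller indices than their children, so the heavy node of
      -- largest index has only light children.
      deepest-heavy : ∃ λ y → Heavy y × (∀ {z} → y F.< z → ¬ Heavy z)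
      deepest-heavy = largest (λ z → k ≤? ∣ below z ─ Bᴬ z ∣) root-heavy

      y : Fin (suc m)
      y = proj₁ deepest-heavy

      y-heavy : Heavy y
      y-heavy = proj₁ (proj₂ deepest-heavy)

      later-light : ∀ {z} → y F.< z → ¬ Heavy z
      later-light = proj₂ (proj₂ deepest-heavy)

      Prefix : ℕ → Pred (Fin (suc m)) 0ℓ
      Prefix t d = toℕ d < t × IsChild T y d

      prefix? : ∀ t → Decidable (Prefix t)
      prefix? t d = (toℕ d ℕ.<? t) ×-dec child? T y d

      Lᵖ : ℕ → Subset n
      Lᵖ t = ⋃[ branches? T (prefix? t) ] Bᴬ

      Pᵖ : ℕ → Subset n
      Pᵖ t = Lᵖ t ─ Bᴬ y

      Pᵖ-zero : ∣ Pᵖ 0 ∣ < k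
      Pᵖ-zero = subst (_< k) (sym (trans (cong ∣_∣ (Empty-unique empty)) (∣⊥∣≡0 n))) k≥1
        where
        empty : Empty (Pᵖ 0)
        empty (v , v∈) =
          let _ , (_ , (d<0 , _) , _) , _ = ∈-⋃⁻ (branches? T (prefix? 0)) (p─q⊆p (Lᵖ 0) (Bᴬ y) v∈)
          in n≮0 d<0

      Pᵖ-full : k ≤ ∣ Pᵖ (suc m) ∣
      Pᵖ-full = ≤-trans y-heavy (p⊆q⇒∣p∣≤∣q∣ λ v∈ → in-prefix v∈ (∈-⋃⁻ (subtree? y) (p─q⊆p (below y) (Bᴬ y) v∈)))
        where
        in-prefix : ∀ {v} → v ∈ below y ─ Bᴬ y → ∃ (λ x → Branches T (_≡ y) x × v ∈ Bᴬ x) → v ∈ Pᵖ (suc m)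
        in-prefix {v} v∈ (x , (_ , refl , x≤y) , v∈x) =
          let d , d-child , x≤d = child-of-descendant T x≤y x≢y in
          x∈p∧x∉q⇒x∈p─q (∈-⋃⁺ (branches? T (prefix? (suc m))) (d , (toℕ<n d , d-child) , x≤d) v∈x) v∉y
          where
          v∉y : v ∉ Bᴬ y
          v∉y = x∈p─q⇒x∉q (below y) (Bᴬ y) v∈
          x≢y : x ≢ y
          x≢y refl = v∉y v∈x

      threshold : ∃ λ t → t < suc m × ∣ Pᵖ t ∣ < k × k ≤ ∣ Pᵖ (suc t) ∣
      threshold = crossing (λ t → ∣ Pᵖ t ∣) (suc m) Pᵖ-zero Pᵖ-full

      t : ℕ
      t = proj₁ threshold

      d : Fin (suc m)
      d = fromℕ< (proj₁ (proj₂ threshold))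

      Pᵖ-light : ∣ Pᵖ t ∣ < k
      Pᵖ-light = proj₁ (proj₂ (proj₂ threshold))

      Pᵖ-heavy : k ≤ ∣ Pᵖ (suc t) ∣
      Pᵖ-heavy = proj₂ (proj₂ (proj₂ threshold))

      prefix-suc : ∀ {d′} → Prefix (suc t) d′ → Prefix t d′ ⊎ d′ ≡ d
      prefix-suc (d′<1+t , d′-child) =
        map (_, d′-child) (λ d′≡t → toℕ-injective (trans d′≡t (sym (toℕ-fromℕ< _)))) (m≤n⇒m<n∨m≡n (s≤s⁻¹ d′<1+t))

      Pᵖ-suc : ∀ {v} → v ∈ Pᵖ (suc t) → v ∈ Pᵖ t ⊎ (v ∈ below d ─ Bᴬ y × IsChild T y d)
      Pᵖ-suc {v} v∈ = split (∈-⋃⁻ (branches? T (prefix? (suc t))) (p─q⊆p (Lᵖ (suc t)) (Bᴬ y) v∈))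
        where
        v∉y : v ∉ Bᴬ y
        v∉y = x∈p─q⇒x∉q (Lᵖ (suc t)) (Bᴬ y) v∈
        next : ∀ {x d′} → v ∈ Bᴬ x → Descendant T x d′ → Prefix (suc t) d′ → Prefix t d′ ⊎ d′ ≡ d →
               v ∈ Pᵖ t ⊎ (v ∈ below d ─ Bᴬ y × IsChild T y d)
        next v∈x x≤d′ _ (inj₁ pre) =
          inj₁ (x∈p∧x∉q⇒x∈p─q (∈-⋃⁺ (branches? T (prefix? t)) (_ , pre , x≤d′) v∈x) v∉y)
        next v∈x x≤d (_ , d-child) (inj₂ refl) =
          inj₂ (x∈p∧x∉q⇒x∈p─q (∈-⋃⁺ (subtree? d) (d , refl , x≤d) v∈x) v∉y , d-child)
        split : ∃ (λ x → Branches T (Prefix (suc t)) x × v ∈ Bᴬ x) → v ∈ Pᵖ t ⊎ (v ∈ below d ─ Bᴬ y × IsChild T y d)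
        split (x , (d′ , pre , x≤d′) , v∈x) = next v∈x x≤d′ pre (prefix-suc pre)

      d-child : IsChild T y d
      d-child = decidable-stable (child? T y d) λ ¬d-child →
        <⇒≱ Pᵖ-light (≤-trans Pᵖ-heavy (p⊆q⇒∣p∣≤∣q∣ ([ id , ⊥-elim ∘ ¬d-child ∘ proj₂ ]′ ∘ Pᵖ-suc)))

      single-branch : k ≤ ∣ below d ─ Bᴬ y ∣ → Cut
      single-branch heavy = record
        { centre = y ; Branch = Branches T (_≡ d) ; branch? = subtree? d
        ; separates = branches-separate-bags (F._≟ d) λ { refl → d-child }
        ; large = heavy
        ; small = ≤-trans (light⇒∣below∣≤k+k (later-light (parent<child T d-child)))
                          (+-monoʳ-≤ k (m≤m+n k (k + 0))) }

      prefix-branches : ∣ below d ─ Bᴬ y ∣ < k → Cut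
      prefix-branches light = record
        { centre = y ; Branch = Branches T (Prefix (suc t)) ; branch? = branches? T (prefix? (suc t))
        ; separates = branches-separate-bags (prefix? (suc t)) proj₂
        ; large = Pᵖ-heavy
        ; small = begin
            ∣ Lᵖ (suc t) ∣                             ≤⟨ ∣p∣≤∣q∣+∣p─q∣ (Lᵖ (suc t)) (Bᴬ y) ⟩
            ∣ Bᴬ y ∣ + ∣ Pᵖ (suc t) ∣                  ≤⟨ +-mono-≤ (∣Bᴬ∣≤1+k y) Pᵖ-bound ⟩
            suc k + (∣ Pᵖ t ∣ + ∣ below d ─ Bᴬ y ∣)    ≤⟨ a<k∧b<k⇒1+k+[a+b]≤3k Pᵖ-light light ⟩
            3 * k                                      ∎ }
        where
        open ≤-Reasoning
        Pᵖ-bound : ∣ Pᵖ (suc t) ∣ ≤ ∣ Pᵖ t ∣ + ∣ below d ─ Bᴬ y ∣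
        Pᵖ-bound = ≤-trans (p⊆q⇒∣p∣≤∣q∣ (x∈p∪q⁺ ∘ map₂ proj₁ ∘ Pᵖ-suc)) (∣p∪q∣≤∣p∣+∣q∣ (Pᵖ t) (below d ─ Bᴬ y))

      cut : Cut
      cut = choose (k ≤? ∣ below d ─ Bᴬ y ∣)
        where
        choose : Dec (k ≤ ∣ below d ─ Bᴬ y ∣) → Cut
        choose (yes heavy) = single-branch heavy
        choose (no  light) = prefix-branches (≰⇒> light)

    module Extend (big : 3 * k < ∣ A ∣) (c : Cut) where
      open Cut c

      L : Subset n
      L = ⋃[ branch? ] Bᴬ

      P : Subset n
      P = L ─ Bᴬ centre

      A′ : Subset n
      A′ = A ─ P

      L⊆A : L ⊆ A
      L⊆A v∈ = let _ , _ , v∈x = ∈-⋃⁻ branch? v∈ in proj₂ (x∈p∩q⁻ _ A v∈x)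

      shrinks : k + ∣ A′ ∣ ≤ ∣ A ∣
      shrinks = begin
        k + ∣ A′ ∣              ≤⟨ +-monoˡ-≤ ∣ A′ ∣ (≤-trans large (p⊆q⇒∣p∣≤∣q∣ P⊆A∩P)) ⟩
        ∣ A ∩ P ∣ + ∣ A ─ P ∣   ≡⟨ sym (∣p∣≡∣p∩q∣+∣p─q∣ A P) ⟩
        ∣ A ∣                   ∎
        where
        open ≤-Reasoning
        P⊆A∩P : P ⊆ A ∩ P
        P⊆A∩P v∈ = x∈p∩q⁺ (L⊆A (p─q⊆p L (Bᴬ centre) v∈) , v∈)

      off-branch : ∀ {x} → ¬ Branch x → Bᴬ x ⊆ A′
      off-branch {x} ¬bx {v} v∈x = x∈p∧x∉q⇒x∈p─q v∈A v∉P
        where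
        v∈Bx : v ∈ B x
        v∈Bx = proj₁ (x∈p∩q⁻ (B x) A v∈x)
        v∈A : v ∈ A
        v∈A = proj₂ (x∈p∩q⁻ (B x) A v∈x)
        v∉P : v ∉ P
        v∉P v∈P = let x′ , bx′ , v∈x′ = ∈-⋃⁻ branch? (p─q⊆p L (Bᴬ centre) v∈P) in
          x∈p─q⇒x∉q L (Bᴬ centre) v∈P (x∈p∩q⁺ (separates bx′ ¬bx (proj₁ (x∈p∩q⁻ (B x′) A v∈x′)) v∈Bx , v∈A))

      extend : Coarsening A′ → Coarsening A
      extend c′ = record
        { tree      = addLeaf tree (image centre)
        ; bags      = bags ▷ L
        ; bags⊆A    = ▷-all (_⊆ A) (λ z v∈ → p─q⊆p A P (bags⊆A z v∈)) L⊆A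
        ; bag-size  = ▷-all (λ X → ∣ X ∣ ≤ 3 * k) bag-size small
        ; connected = λ v∈A → connected′ v∈A (_ ∈? P)
        ; image     = λ x → place (branch? x)
        ; covers    = λ x → covers′ (branch? x)
        ; few-nodes = inj₁ ([ more-nodes , two-nodes ]′ few-nodes) }
        where
        open Coarsening c′

        connected′ : ∀ {v} → v ∈ A → Dec (v ∈ P) →
                     ConnectedSubtree (addLeaf tree (image centre)) (λ z → v ∈ (bags ▷ L) z)
        connected′ {v} v∈A (yes v∈P) = addLeaf-isolated tree (image centre) bags L v
          (λ z v∈z → x∈p─q⇒x∉q A P (bags⊆A z v∈z) v∈P) (p─q⊆p L (Bᴬ centre) v∈P)
        connected′ {v} v∈A (no v∉P) = addLeaf-connected tree (image centre) bags L v (connected v∈A′) attached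
          where
          v∈A′ : v ∈ A′
          v∈A′ = x∈p∧x∉q⇒x∈p─q v∈A v∉P
          attached : v ∈ L → v ∈ bags (image centre)
          attached v∈L = covers centre (x∈p∩q⁺ (proj₁ (x∈p∩q⁻ (B centre) A (x∈p∧x∉p─q⇒x∈q v∈L v∉P)) , v∈A′))

        place : ∀ {x} → Dec (Branch x) → Fin (suc (suc m′))
        place     (yes _) = fromℕ (suc m′)
        place {x} (no  _) = inject₁ (image x)

        covers′ : ∀ {x} (b : Dec (Branch x)) → B x ∩ A ⊆ (bags ▷ L) (place b)
        covers′     (yes bx)  v∈ = ∈-▷-fromℕ bags L (∈-⋃⁺ branch? bx v∈)
        covers′ {x} (no  ¬bx) v∈ =
          ∈-▷-inject₁ bags L (covers x (x∈p∩q⁺ (proj₁ (x∈p∩q⁻ (B x) A v∈) , off-branch ¬bx v∈)))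

        more-nodes : suc m′ * k + k ≤ ∣ A′ ∣ → suc (suc m′) * k + k ≤ ∣ A ∣
        more-nodes enough = begin
          (k + suc m′ * k) + k    ≡⟨ +-assoc k (suc m′ * k) k ⟩
          k + (suc m′ * k + k)    ≤⟨ +-monoʳ-≤ k enough ⟩
          k + ∣ A′ ∣              ≤⟨ shrinks ⟩
          ∣ A ∣                   ∎
          where open ≤-Reasoning

        two-nodes : m′ ≡ 0 → suc (suc m′) * k + k ≤ ∣ A ∣
        two-nodes m′≡0 = subst (λ j → suc (suc j) * k + k ≤ ∣ A ∣) (sym m′≡0)
                               (≤-trans (≤-reflexive (+-comm (2 * k) k)) (<⇒≤ big))

  coarsen : ∀ A → Coarsening A
  coarsen A = go A (On.wellFounded ∣_∣ <-wellFounded A)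
    where
    go : ∀ A → Acc (_<_ on ∣_∣) A → Coarsening A
    go A (acc rec) = split (∣ A ∣ ≤? 3 * k)
      where
      split : Dec (∣ A ∣ ≤ 3 * k) → Coarsening A
      split (yes small) = single-bag A small
      split (no ¬small) = extend (go A′ (rec (≤-trans (+-monoˡ-≤ ∣ A′ ∣ k≥1) shrinks)))
        where open Extend A (≰⇒> ¬small) (cut A (≰⇒> ¬small))

theorem3 : ∀ {n} (G : Graph n) (k : ℕ) → TwAtMost G k → 1 ≤ k →
    Σ ℕ λ m → Σ (TreeDecomposition G m) λ D →
      WidthAtMost D (3 * k ∸ 1) × ((suc m * k + k ≤ n) ⊎ (suc m ≤ 1))
theorem3 {n} G k (_ , D , narrow) k≥1 = m′ , coarse , wide , few
  where
  open TreeDecomposition D using (tree; bags; isDec)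
  open IsTDecomposition isDec using (edges; subtrees)
  open Coarsen k≥1 tree bags narrow subtrees using (coarsen; module Coarsening)
  open Coarsening (coarsen ⊤) renaming (tree to coarse-tree; bags to coarse-bags)

  coarse : TreeDecomposition G m′
  coarse = record
    { tree = coarse-tree ; bags = coarse-bags
    ; isDec = record
      { edges    = λ v w vw → let x , v∈x , w∈x = edges v w vw in
                   image x , covers x (x∈p∩q⁺ (v∈x , ∈⊤)) , covers x (x∈p∩q⁺ (w∈x , ∈⊤))
      ; subtrees = λ v → connected ∈⊤ } }

  wide : WidthAtMost coarse (3 * k ∸ 1)
  wide z = ≤-trans (bag-size z) (m≤n+m∸n (3 * k) 1)

  few : (suc m′ * k + k ≤ n) ⊎ (suc m′ ≤ 1)
  few = map (subst (suc m′ * k + k ≤_) (∣⊤∣≡n n)) (≤-reflexive ∘ cong suc) few-nodes
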